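{- Let $G$ be a finite simple triangle-free graph with minimum degree $\delta \ge 2$. Suppose that for every minimum zero forcing set $S$ of $G$, there are two adjacent vertices of $S$ which both force at time $t=1$. Then $2\delta - 2 \le Z(G)$.
   Context: Zero forcing process on a graph $G=(V,E)$: start with an initial set $S_0 = S\subseteq V$ of colored vertices. A colored vertex $v$ forces an uncolored neighbor $w$ (making $w$ colored) if $w$ is the only uncolored neighbor of $v$. At each time step $t\ge 1$, all possible forces by vertices colored in $S_{t-1}$ are performed simultaneously, and $S_t$ is $S_{t-1}$ together with all vertices forced at time $t$; thus a vertex forces at time $t=1$ if it lies in $S_0$ and has exactly one neighbor outside $S_0$. $S$ is a zero forcing set if $S_t=V$ for some $t$. $Z(G)$ is the minimum size of a zero forcing set; a minimum zero forcing set has size $Z(G)$. Triangle-free means no cycle of length 3. -}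

module Defs where

open import Data.Nat using (ℕ; zero; suc; _≤_)
open import Data.Fin using (Fin)
open import Data.Fin.Subset using (Subset; _∈_; _∉_; ∣_∣)
open import Data.List using (List; length; filter; allFin)
open import Data.Product using (Σ; _×_; ∃)
open import Data.Sum using (_⊎_)
open import Data.Empty using (⊥)
open import Relation.Nullary using (¬_)
open import Relation.Unary using (Decidable)
open import Relation.Binary.PropositionalEquality using (_≡_)

record Graph (n : ℕ) : Set₁ where
  field
    Adj     : Fin n → Fin n → Set
    adj?    : (u v : Fin n) → Relation.Nullary.Dec (Adj u v)
    sym     : ∀ {u v} → Adj u v → Adj v u
    irrefl  : ∀ {u} → ¬ Adj u u

open Graph public

degree : ∀ {n} (G : Graph n) → Fin n → ℕ
degree G v = length (filter (adj? G v) (allFin _))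

IsMinDegree : ∀ {n} (G : Graph n) → ℕ → Set
IsMinDegree G δ = (∀ v → δ ≤ degree G v) × ∃ λ v → degree G v ≡ δ

TriangleFree : ∀ {n} (G : Graph n) → Set
TriangleFree G = ∀ u v w → Adj G u v → Adj G v w → Adj G w u → ⊥

Forces : ∀ {n} (G : Graph n) → (Fin n → Set) → Fin n → Fin n → Set
Forces G C v w =
  C v × ¬ C w × Adj G v w × (∀ u → Adj G v u → ¬ C u → u ≡ w)

-- S_t: coloured set after t time steps starting from S_0 = S
Coloured : ∀ {n} (G : Graph n) → Subset n → ℕ → Fin n → Set
Coloured G S zero    w = w ∈ S
Coloured G S (suc t) w =
  Coloured G S t w ⊎ ∃ λ v → Forces G (Coloured G S t) v w

IsZeroForcingSet : ∀ {n} (G : Graph n) → Subset n → Set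
IsZeroForcingSet G S = ∃ λ t → ∀ w → Coloured G S t w

-- a zero forcing set of minimum size (size = Z(G))
IsMinZeroForcingSet : ∀ {n} (G : Graph n) → Subset n → Set
IsMinZeroForcingSet G S =
  IsZeroForcingSet G S × (∀ T → IsZeroForcingSet G T → ∣ S ∣ ≤ ∣ T ∣)

-- v forces (some vertex) at time t = 1, i.e. v ∈ S_0 forces w ∉ S_0
ForcesAtTime1 : ∀ {n} (G : Graph n) → Subset n → Fin n → Set
ForcesAtTime1 G S v = ∃ λ w → Forces G (Coloured G S zero) v w

module Submission where

-- Let S be a minimum zero forcing set and let u, v ∈ S
-- be adjacent vertices that both force at time 1, say u forces w and
-- v forces w'.  A vertex forcing at time 1 has all of its neighbours in
-- S except the one it forces, so N(u) ⊆ S ∪ {w} and N(v) ⊆ S ∪ {w'}.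
-- As G is triangle-free, the adjacent vertices u and v have no common
-- neighbour, hence
--     2δ ≤ deg u + deg v = |N(u) ∪ N(v)| ≤ |S ∪ {w} ∪ {w'}| ≤ |S| + 2.

open import Defs
open import Data.Nat using (ℕ; _≤_; _*_; _∸_)
open import Data.Fin.Subset using (Subset; _∈_; ∣_∣)
open import Data.Product using (_×_; ∃)

open import Data.Bool using (true; false)
open import Data.Nat using (zero; suc; _+_; z≤n; s≤s)
open import Data.Nat.Properties
  using (≤-reflexive; +-mono-≤; +-comm; +-identityʳ; m≤n+o⇒m∸n≤o;
         +-0-commutativeMonoid; module ≤-Reasoning)
open import Data.Fin using (Fin; zero; suc; _≟_)
open import Data.Fin.Properties using (suc-injective)
open import Data.Fin.Subset using (inside; outside)
open import Data.Fin.Subset.Properties using (_∈?_; drop-there)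
open import Data.Vec using (there; []; _∷_)
open import Data.List using (length; filter; tabulate)
open import Data.Product using (_,_)
open import Data.Sum using (_⊎_; inj₁; inj₂)
open import Data.Empty using (⊥-elim)
open import Function using (_∘_; id)
open import Relation.Nullary using (Dec; yes; no; ¬_; _because_; _⊎-dec_)
open import Relation.Binary.PropositionalEquality
  using (_≡_; refl; trans; cong; cong₂; module ≡-Reasoning) renaming (sym to ≡-sym)
open import Algebra.Properties.CommutativeMonoid.Sum +-0-commutativeMonoid
  using (sum; ∑-distrib-+; sum-cong-≗; sum-replicate-zero)

indicator : ∀ {A : Set} → Dec A → ℕ
indicator (true  because _) = 1
indicator (false because _) = 0

indicator-cong : ∀ {A B : Set} (a : Dec A) (b : Dec B) →
  (A → B) → (B → A) → indicator a ≡ indicator b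
indicator-cong (yes _) (yes _) _   _   = refl
indicator-cong (yes x) (no ¬y) A⇒B _   = ⊥-elim (¬y (A⇒B x))
indicator-cong (no ¬x) (yes y) _   B⇒A = ⊥-elim (¬x (B⇒A y))
indicator-cong (no _)  (no _)  _   _   = refl

indicator-refuted : ∀ {A : Set} (a : Dec A) → ¬ A → indicator a ≡ 0
indicator-refuted (yes x) ¬x = ⊥-elim (¬x x)
indicator-refuted (no _)  _  = refl

indicator-disjoint : ∀ {A B : Set} (a : Dec A) (b : Dec B) →
  ¬ (A × B) → indicator a + indicator b ≡ indicator (a ⊎-dec b)
indicator-disjoint (yes x) (yes y) disj = ⊥-elim (disj (x , y))
indicator-disjoint (yes _) (no _)  _    = refl
indicator-disjoint (no _)  (yes _) _    = refl
indicator-disjoint (no _)  (no _)  _    = refl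

indicator-cover : ∀ {A B C : Set} (a : Dec A) (b : Dec B) (c : Dec C) →
  (A → B ⊎ C) → indicator a ≤ indicator b + indicator c
indicator-cover (no _)  _       _       _   = z≤n
indicator-cover (yes _) (yes _) _       _   = s≤s z≤n
indicator-cover (yes _) (no _)  (yes _) _   = s≤s z≤n
indicator-cover (yes x) (no ¬y) (no ¬z) cov with cov x
... | inj₁ y = ⊥-elim (¬y y)
... | inj₂ z = ⊥-elim (¬z z)

sum-mono-≤ : ∀ {n} (f g : Fin n → ℕ) → (∀ x → f x ≤ g x) → sum f ≤ sum g
sum-mono-≤ {zero}  f g f≤g = z≤n
sum-mono-≤ {suc n} f g f≤g =
  +-mono-≤ (f≤g zero) (sum-mono-≤ (f ∘ suc) (g ∘ suc) (f≤g ∘ suc))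

count : ∀ {n} {P : Fin n → Set} → (∀ x → Dec (P x)) → ℕ
count P? = sum (λ x → indicator (P? x))

_∪?_ : ∀ {n} {P Q : Fin n → Set} → (∀ x → Dec (P x)) → (∀ x → Dec (Q x)) →
  ∀ x → Dec (P x ⊎ Q x)
(P? ∪? Q?) x = P? x ⊎-dec Q? x

count-disjoint-union : ∀ {n} {P Q : Fin n → Set}
  (P? : ∀ x → Dec (P x)) (Q? : ∀ x → Dec (Q x)) →
  (∀ x → ¬ (P x × Q x)) → count P? + count Q? ≡ count (P? ∪? Q?)
count-disjoint-union P? Q? disj = begin
  count P? + count Q?
    ≡⟨ ≡-sym (∑-distrib-+ (indicator ∘ P?) (indicator ∘ Q?)) ⟩
  sum (λ x → indicator (P? x) + indicator (Q? x))
    ≡⟨ sum-cong-≗ (λ x → indicator-disjoint (P? x) (Q? x) (disj x)) ⟩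
  count (P? ∪? Q?) ∎
  where open ≡-Reasoning

count-cover : ∀ {n} {P A B : Fin n → Set} (P? : ∀ x → Dec (P x))
  (A? : ∀ x → Dec (A x)) (B? : ∀ x → Dec (B x)) →
  (∀ x → P x → A x ⊎ B x) → count P? ≤ count A? + count B?
count-cover P? A? B? cov = begin
  count P?
    ≤⟨ sum-mono-≤ _ _ (λ x → indicator-cover (P? x) (A? x) (B? x) (cov x)) ⟩
  sum (λ x → indicator (A? x) + indicator (B? x))
    ≡⟨ ∑-distrib-+ (indicator ∘ A?) (indicator ∘ B?) ⟩
  count A? + count B? ∎
  where open ≤-Reasoning

count-singleton : ∀ {n} (w : Fin n) → count (_≟ w) ≡ 1
count-singleton {suc n} zero = cong suc (begin
  count {n} (λ x → suc x ≟ zero)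
    ≡⟨ sum-cong-≗ {n} (λ x → indicator-refuted (suc x ≟ zero) λ ()) ⟩
  sum {n} (λ _ → 0)
    ≡⟨ sum-replicate-zero n ⟩
  0 ∎)
  where open ≡-Reasoning
count-singleton {suc n} (suc w) = begin
  count {n} (λ x → suc x ≟ suc w)
    ≡⟨ sum-cong-≗ (λ x → indicator-cong (suc x ≟ suc w) (x ≟ w) suc-injective (cong suc)) ⟩
  count (_≟ w)
    ≡⟨ count-singleton w ⟩
  1 ∎
  where open ≡-Reasoning

length-filter-tabulate : ∀ {m n} {P : Fin m → Set} (P? : ∀ x → Dec (P x))
  (g : Fin n → Fin m) → length (filter P? (tabulate g)) ≡ count (P? ∘ g)
length-filter-tabulate {n = zero}  P? g = refl
length-filter-tabulate {n = suc n} P? g with P? (g zero)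
... | yes _ = cong suc (length-filter-tabulate P? (g ∘ suc))
... | no _  = length-filter-tabulate P? (g ∘ suc)

degree-count : ∀ {n} (G : Graph n) (v : Fin n) → degree G v ≡ count (adj? G v)
degree-count G v = length-filter-tabulate (adj? G v) id

count-∈-tail : ∀ {n} b (S : Subset n) → count (λ x → suc x ∈? (b ∷ S)) ≡ count (_∈? S)
count-∈-tail b S = sum-cong-≗ λ x → indicator-cong (suc x ∈? (b ∷ S)) (x ∈? S) drop-there there

card-count : ∀ {n} (S : Subset n) → ∣ S ∣ ≡ count (_∈? S)
card-count []            = refl
card-count (inside ∷ S)  = cong suc (trans (card-count S) (≡-sym (count-∈-tail inside S)))
card-count (outside ∷ S) = trans (card-count S) (≡-sym (count-∈-tail outside S))

forcer-neighbourhood : ∀ {n} (G : Graph n) (S : Subset n) {v w : Fin n} →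
  Forces G (_∈ S) v w → ∀ x → Adj G v x → x ∈ S ⊎ x ≡ w
forcer-neighbourhood G S (_ , _ , _ , unique) x vx with x ∈? S
... | yes x∈S = inj₁ x∈S
... | no  x∉S = inj₂ (unique x vx x∉S)

no-common-neighbour : ∀ {n} (G : Graph n) → TriangleFree G →
  ∀ {u v} → Adj G u v → ∀ x → ¬ (Adj G u x × Adj G v x)
no-common-neighbour G tf {u} {v} uv x (ux , vx) = tf u v x uv vx (sym G ux)

-- Two adjacent vertices of a triangle-free graph that force w and w'
-- with respect to S have together at most |S| + 2 neighbours: their
-- neighbourhoods are disjoint and lie inside S ∪ {w} ∪ {w'}.
adjacent-forcers-degree : ∀ {n} (G : Graph n) (S : Subset n) → TriangleFree G →
  ∀ {u v w w'} → Adj G u v → Forces G (_∈ S) u w → Forces G (_∈ S) v w' →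
  degree G u + degree G v ≤ ∣ S ∣ + 2
adjacent-forcers-degree G S tf {u} {v} {w} {w'} uv u→w v→w' = begin
  degree G u + degree G v
    ≡⟨ cong₂ _+_ (degree-count G u) (degree-count G v) ⟩
  count (adj? G u) + count (adj? G v)
    ≡⟨ count-disjoint-union (adj? G u) (adj? G v) (no-common-neighbour G tf uv) ⟩
  count (adj? G u ∪? adj? G v)
    ≤⟨ count-cover _ (_∈? S) ((_≟ w) ∪? (_≟ w')) covered ⟩
  count (_∈? S) + count ((_≟ w) ∪? (_≟ w'))
    ≤⟨ +-mono-≤ (≤-reflexive (≡-sym (card-count S))) (count-cover _ (_≟ w) (_≟ w') (λ _ → id)) ⟩
  ∣ S ∣ + (count (_≟ w) + count (_≟ w'))
    ≡⟨ cong₂ (λ a b → ∣ S ∣ + (a + b)) (count-singleton w) (count-singleton w') ⟩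
  ∣ S ∣ + 2 ∎
  where
  open ≤-Reasoning
  covered : ∀ x → Adj G u x ⊎ Adj G v x → x ∈ S ⊎ (x ≡ w ⊎ x ≡ w')
  covered x (inj₁ ux) with forcer-neighbourhood G S u→w x ux
  ... | inj₁ x∈S = inj₁ x∈S
  ... | inj₂ x≡w = inj₂ (inj₁ x≡w)
  covered x (inj₂ vx) with forcer-neighbourhood G S v→w' x vx
  ... | inj₁ x∈S  = inj₁ x∈S
  ... | inj₂ x≡w' = inj₂ (inj₂ x≡w')

double-min-bound : ∀ {δ a b s} → δ ≤ a → δ ≤ b → a + b ≤ s + 2 → 2 * δ ∸ 2 ≤ s
double-min-bound {δ} {a} {b} {s} δ≤a δ≤b a+b≤s+2 = m≤n+o⇒m∸n≤o (2 * δ) 2 (begin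
  2 * δ   ≡⟨ cong (δ +_) (+-identityʳ δ) ⟩
  δ + δ   ≤⟨ +-mono-≤ δ≤a δ≤b ⟩
  a + b   ≤⟨ a+b≤s+2 ⟩
  s + 2   ≡⟨ +-comm s 2 ⟩
  2 + s   ∎)
  where open ≤-Reasoning

lemma3 : ∀ {n} (G : Graph n) (δ : ℕ) →
    TriangleFree G → IsMinDegree G δ → 2 ≤ δ →
    (∀ S → IsMinZeroForcingSet G S →
      ∃ λ u → ∃ λ v → u ∈ S × v ∈ S × Adj G u v ×
        ForcesAtTime1 G S u × ForcesAtTime1 G S v) →
    ∀ S → IsMinZeroForcingSet G S → 2 * δ ∸ 2 ≤ ∣ S ∣
lemma3 G δ tf (δ≤degree , _) _ adjacent-forcers S minS
  with adjacent-forcers S minS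
... | u , v , _ , _ , uv , (w , u→w) , (w' , v→w') =
  double-min-bound (δ≤degree u) (δ≤degree v)
    (adjacent-forcers-degree G S tf uv u→w v→w')
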